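{- Let $((A_i,B_i))_{i\in\mathbb N}$ be an increasing sequence of oriented separations of a graph $G$, and let $(A,B)=(\bigcup_iA_i,\bigcap_iB_i)$ be its limit. If a separation $\{C,D\}$ of $G$ crosses $\{A,B\}$, then there exists $I\in\mathbb N$ such that $\{C,D\}$ crosses $\{A_i,B_i\}$ for all $i\ge I$.
   Context: A separation of a graph $G$ is an unordered pair $\{A,B\}$ of subsets of $V(G)$ with $A\cup B=V(G)$ and no edge between $A\setminus B$ and $B\setminus A$; its orientations are $(A,B)$ and $(B,A)$, ordered by $(A,B)\le(C,D)$ iff $A\subseteq C$ and $B\supseteq D$. Two separations are nested if they have comparable orientations, and cross otherwise. -}

module Defs where

open import Data.Nat using (ℕ; _≤_)
open import Data.Product using (Σ; _×_; _,_; ∃)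
open import Data.Sum using (_⊎_)
open import Data.Empty using (⊥)
open import Relation.Nullary using (¬_)
open import Relation.Unary using (Pred; _⊆_)
open import Level using (0ℓ)

record Graph : Set₁ where
  field
    V   : Set
    E   : V → V → Set
    sym : ∀ {u v} → E u v → E v u

VSet : Graph → Set₁
VSet G = Pred (Graph.V G) 0ℓ

IsSeparation : (G : Graph) → VSet G → VSet G → Set
IsSeparation G A B =
  (∀ v → A v ⊎ B v) ×
  (∀ u v → Graph.E G u v → (A u × ¬ B u) → (B v × ¬ A v) → ⊥)

_≤ₛ_ : {G : Graph} → (VSet G × VSet G) → (VSet G × VSet G) → Set
(A , B) ≤ₛ (C , D) = (A ⊆ C) × (D ⊆ B)

IsOrientationOf : {G : Graph} → (VSet G × VSet G) → VSet G → VSet G → Set₁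
IsOrientationOf {G} (X , Y) A B = ((X , Y) ≡ (A , B)) ⊎ ((X , Y) ≡ (B , A))
  where open import Relation.Binary.PropositionalEquality using (_≡_)

Nested : {G : Graph} → VSet G → VSet G → VSet G → VSet G → Set₁
Nested {G} A B C D =
  Σ (VSet G × VSet G) λ s → Σ (VSet G × VSet G) λ t →
    IsOrientationOf {G} s A B × IsOrientationOf {G} t C D ×
    (_≤ₛ_ {G} s t ⊎ _≤ₛ_ {G} t s)

Cross : {G : Graph} → VSet G → VSet G → VSet G → VSet G → Set₁
Cross {G} A B C D = ¬ Nested {G} A B C D

LimA : {G : Graph} → (ℕ → VSet G) → VSet G
LimA A v = ∃ λ i → A i v

LimB : {G : Graph} → (ℕ → VSet G) → VSet G
LimB B v = ∀ i → B i v

{-# OPTIONS --safe #-}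
module Submission where

-- Argue classically. If the conclusion fails, {C,D} is nested with {Aᵢ,Bᵢ} for
-- cofinally many i. No orientation t of {C,D} can lie below such an (Aᵢ,Bᵢ), for
-- then t ≤ (Aᵢ,Bᵢ) ≤ (A,B) and {C,D} would be nested with {A,B}. So cofinally
-- often (Aᵢ,Bᵢ) lies below an orientation of {C,D}, and by pigeonhole below the
-- same orientation t. The sequence is increasing, so then every (Aᵢ,Bᵢ) ≤ t, and
-- as (A,B) is their supremum, (A,B) ≤ t: again {C,D} is nested with {A,B}.

open import Defs
open import Data.Nat using (ℕ; _≤_; _⊔_)
open import Data.Nat.Properties using (≤-trans; m≤m⊔n; m≤n⊔m)
open import Data.Product using (_×_; _,_; ∃; proj₁; proj₂; swap)
open import Data.Sum using (_⊎_; inj₁; inj₂)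
import Data.Sum as Sum
open import Data.Empty using (⊥-elim)
open import Relation.Nullary using (¬_; yes; no)
open import Relation.Nullary.Decidable using (map′)
open import Relation.Binary.PropositionalEquality using (refl)
open import Axiom.ExcludedMiddle using (ExcludedMiddle)
open import Axiom.DoubleNegationElimination using (DoubleNegationElimination; em⇒dne)
open import Level using (Level; Lift; lift; lower; 0ℓ)

excludedMiddle-lower : ∀ {a} b → ExcludedMiddle (a Level.⊔ b) → ExcludedMiddle a
excludedMiddle-lower b em = map′ lower lift (em {Lift b _})

module _ {ℓ : Level} where

  Cofinal : (ℕ → Set ℓ) → Set ℓ
  Cofinal P = ∀ I → ∃ λ i → I ≤ i × P i

  ¬eventually¬⇒cofinal : DoubleNegationElimination ℓ → {P : ℕ → Set ℓ} →
    ¬ (∃ λ I → ∀ i → I ≤ i → ¬ P i) → Cofinal P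
  ¬eventually¬⇒cofinal dne ¬eventually I =
    dne λ ¬later → ¬eventually (I , λ i I≤i p → ¬later (i , I≤i , p))

  cofinal-⊎ : ExcludedMiddle ℓ → {P Q : ℕ → Set ℓ} →
    Cofinal (λ i → P i ⊎ Q i) → Cofinal P ⊎ Cofinal Q
  cofinal-⊎ em {P} {Q} cof with em {Cofinal P}
  ... | yes cofP = inj₁ cofP
  ... | no ¬cofP = inj₂ λ I → em⇒dne em λ ¬laterQ → ¬cofP λ J → pick I J ¬laterQ (cof (I ⊔ J))
    where
    pick : ∀ I J → ¬ (∃ λ i → I ≤ i × Q i) →
           (∃ λ i → I ⊔ J ≤ i × (P i ⊎ Q i)) → ∃ λ i → J ≤ i × P i
    pick I J _       (i , le , inj₁ p) = i , ≤-trans (m≤n⊔m I J) le , p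
    pick I J ¬laterQ (i , le , inj₂ q) = ⊥-elim (¬laterQ (i , ≤-trans (m≤m⊔n I J) le , q))

  cofinal-downwardClosed⇒all : {P : ℕ → Set ℓ} → (∀ {i j} → i ≤ j → P j → P i) →
    Cofinal P → ∀ i → P i
  cofinal-downwardClosed⇒all down cof i with cof i
  ... | j , i≤j , p = down i≤j p

cofinal-map : ∀ {p q} {P : ℕ → Set p} {Q : ℕ → Set q} →
  (∀ {i} → P i → Q i) → Cofinal P → Cofinal Q
cofinal-map f cof I with cof I
... | i , I≤i , p = i , I≤i , f p

module OrientedSeparations (G : Graph) where

  Oriented : Set₁
  Oriented = VSet G × VSet G

  infix 4 _⊑_
  _⊑_ : Oriented → Oriented → Set
  _⊑_ = _≤ₛ_ {G}

  ⊑-trans : ∀ {s t u} → s ⊑ t → t ⊑ u → s ⊑ u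
  ⊑-trans (A⊆C , D⊆B) (C⊆E , F⊆D) = (λ a → C⊆E (A⊆C a)) , (λ f → D⊆B (F⊆D f))

  BelowOrientationOf : Oriented → VSet G → VSet G → Set
  BelowOrientationOf s C D = s ⊑ (C , D) ⊎ s ⊑ (D , C)

  AboveOrientationOf : Oriented → VSet G → VSet G → Set
  AboveOrientationOf s C D = (C , D) ⊑ s ⊎ (D , C) ⊑ s

  nested⇒below⊎above : ∀ {A B C D} → Nested {G} A B C D →
    BelowOrientationOf (A , B) C D ⊎ AboveOrientationOf (A , B) C D
  nested⇒below⊎above (_ , _ , inj₁ refl , inj₁ refl , inj₁ le) = inj₁ (inj₁ le)
  nested⇒below⊎above (_ , _ , inj₁ refl , inj₂ refl , inj₁ le) = inj₁ (inj₂ le)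
  nested⇒below⊎above (_ , _ , inj₁ refl , inj₁ refl , inj₂ le) = inj₂ (inj₁ le)
  nested⇒below⊎above (_ , _ , inj₁ refl , inj₂ refl , inj₂ le) = inj₂ (inj₂ le)
  nested⇒below⊎above (_ , _ , inj₂ refl , inj₁ refl , inj₁ le) = inj₂ (inj₂ (swap le))
  nested⇒below⊎above (_ , _ , inj₂ refl , inj₂ refl , inj₁ le) = inj₂ (inj₁ (swap le))
  nested⇒below⊎above (_ , _ , inj₂ refl , inj₁ refl , inj₂ le) = inj₁ (inj₂ (swap le))
  nested⇒below⊎above (_ , _ , inj₂ refl , inj₂ refl , inj₂ le) = inj₁ (inj₁ (swap le))

  above-⊑ : ∀ {s u C D} → AboveOrientationOf s C D → s ⊑ u → AboveOrientationOf u C D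
  above-⊑ above s⊑u = Sum.map (λ le → ⊑-trans le s⊑u) (λ le → ⊑-trans le s⊑u) above

  below⇒nested : ∀ {A B C D} → BelowOrientationOf (A , B) C D → Nested {G} A B C D
  below⇒nested (inj₁ le) = _ , _ , inj₁ refl , inj₁ refl , inj₁ le
  below⇒nested (inj₂ le) = _ , _ , inj₁ refl , inj₂ refl , inj₁ le

  above⇒nested : ∀ {A B C D} → AboveOrientationOf (A , B) C D → Nested {G} A B C D
  above⇒nested (inj₁ le) = _ , _ , inj₁ refl , inj₁ refl , inj₂ le
  above⇒nested (inj₂ le) = _ , _ , inj₁ refl , inj₂ refl , inj₂ le

  module _ (A B : ℕ → VSet G) where

    Lim : Oriented
    Lim = LimA {G} A , LimB {G} B

    ⊑-Lim : ∀ i → (A i , B i) ⊑ Lim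
    ⊑-Lim i = (λ a → i , a) , (λ b → b i)

    Lim-⊑ : ∀ {t} → (∀ i → (A i , B i) ⊑ t) → Lim ⊑ t
    Lim-⊑ bound = (λ { (i , a) → proj₁ (bound i) a }) , (λ d i → proj₂ (bound i) d)

    cofinal⊑⇒Lim-⊑ : (∀ i j → i ≤ j → (A i , B i) ⊑ (A j , B j)) →
      ∀ {t} → Cofinal (λ i → (A i , B i) ⊑ t) → Lim ⊑ t
    cofinal⊑⇒Lim-⊑ mono cof =
      Lim-⊑ (cofinal-downwardClosed⇒all (λ {i} {j} i≤j → ⊑-trans (mono i j i≤j)) cof)

lemma3p9 : ExcludedMiddle (Level.suc 0ℓ) →
    (G : Graph) (A B : ℕ → VSet G) →
    (∀ i → IsSeparation G (A i) (B i)) →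
    (∀ i j → i ≤ j → _≤ₛ_ {G} (A i , B i) (A j , B j)) →
    (C D : VSet G) → IsSeparation G C D →
    Cross {G} (LimA {G} A) (LimB {G} B) C D →
    ∃ λ I → ∀ i → I ≤ i → Cross {G} (A i) (B i) C D
lemma3p9 em G A B _ mono C D _ cross = em⇒dne em λ ¬eventually →
  cross (below⇒nested (Lim-below (cofinal-map nested⇒below
    (¬eventually¬⇒cofinal (em⇒dne em) ¬eventually))))
  where
  open OrientedSeparations G

  nested⇒below : ∀ {i} → Nested {G} (A i) (B i) C D → BelowOrientationOf (A i , B i) C D
  nested⇒below {i} nested with nested⇒below⊎above nested
  ... | inj₁ below = below
  ... | inj₂ above = ⊥-elim (cross (above⇒nested (above-⊑ above (⊑-Lim A B i))))

  Lim-below : Cofinal (λ i → BelowOrientationOf (A i , B i) C D) → BelowOrientationOf (Lim A B) C D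
  Lim-below cof = Sum.map (cofinal⊑⇒Lim-⊑ A B mono) (cofinal⊑⇒Lim-⊑ A B mono)
    (cofinal-⊎ (excludedMiddle-lower (Level.suc 0ℓ) em) cof)
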